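{- Let $G$ be a connected graph with diameter $D$ and let $W=\{w_1,\dots,w_k\}\subseteq V(G)$. Suppose $\varphi$ is a $W$-resolved embedding of $G$ in $P_{D+1}^{\boxtimes,k}$. Then for every $x\in V(G)$ and every $1\le i\le k$, \[ d_{\varphi(G)}(\varphi(x),\varphi(w_i))=d_{P_{D+1}^{\boxtimes,k}}(\varphi(x),\varphi(w_i)). \]
   Context: $P_n$ denotes the path with vertex set $\{0,1,\dots,n-1\}$, where $i$ and $i+1$ are adjacent. The strong product $G_1\boxtimes\cdots\boxtimes G_k$ has vertex set $V(G_1)\times\cdots\times V(G_k)$, two distinct vertices $(x_1,\dots,x_k),(y_1,\dots,y_k)$ being adjacent iff for every $i$, $x_i=y_i$ or $x_iy_i\in E(G_i)$; $G^{\boxtimes,k}$ is the strong product of $k$ copies of $G$. Thus in $P_n^{\boxtimes,k}$, $d(x,y)=\max_i|x_i-y_i|$. An embedding of $G$ in $H$ is an injective map $\varphi:V(G)\to V(H)$ such that $xy\in E(G)$ implies $\varphi(x)\varphi(y)\in E(H)$; $\varphi(G)$ denotes the subgraph of $H$ induced by $\varphi(V(G))$. For $W=\{w_1,\dots,w_k\}\subseteq V(G)$ and a path $P$, a $W$-resolved embedding of $G$ in $P^{\boxtimes,k}$ is an embedding $\varphi$ such that for every $x\in V(G)$, $\varphi(x)=\big(d_{\varphi(G)}(\varphi(x),\varphi(w_1)),\dots,d_{\varphi(G)}(\varphi(x),\varphi(w_k))\big)$. -}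

module Defs where

open import Level using (0ℓ)
open import Data.Nat using (ℕ; zero; suc; _≤_)
open import Data.Fin using (Fin; toℕ)
open import Data.Product using (Σ; _×_; ∃; ∃-syntax)
open import Relation.Binary.PropositionalEquality using (_≡_)
open import Relation.Nullary using (¬_)
open import Function.Definitions using (Injective)

record Graph : Set₁ where
  field
    n     : ℕ
    Adj   : Fin n → Fin n → Set
    sym   : ∀ {x y} → Adj x y → Adj y x
    irrefl : ∀ {x} → ¬ Adj x x
open Graph public

data Walk {V : Set} (R : V → V → Set) : V → V → ℕ → Set where
  here : ∀ {x} → Walk R x x zero
  step : ∀ {x y z l} → R x y → Walk R y z l → Walk R x z (suc l)

IsDist : {V : Set} → (V → V → Set) → V → V → ℕ → Set
IsDist R x y d = Walk R x y d × (∀ l → Walk R x y l → d ≤ l)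

Connected : Graph → Set
Connected G = ∀ (x y : Fin (n G)) → ∃[ l ] Walk (Adj G) x y l

HasDiameter : Graph → ℕ → Set
HasDiameter G D =
  (∀ x y d → IsDist (Adj G) x y d → d ≤ D)
  × (∃[ x ] ∃[ y ] IsDist (Adj G) x y D)

PathAdj : (m : ℕ) → Fin m → Fin m → Set
PathAdj m i j = (suc (toℕ i) ≡ toℕ j) Data.Sum.⊎ (suc (toℕ j) ≡ toℕ i)
  where import Data.Sum

PVert : ℕ → ℕ → Set
PVert m k = Fin k → Fin m

StrongAdj : (m k : ℕ) → PVert m k → PVert m k → Set
StrongAdj m k x y =
  ¬ (∀ i → x i ≡ y i) × (∀ i → (x i ≡ y i) Data.Sum.⊎ PathAdj m (x i) (y i))
  where import Data.Sum

IsEmbedding : (G : Graph) {V : Set} → (V → V → Set) → (Fin (n G) → V) → Set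
IsEmbedding G R φ = Injective _≡_ _≡_ φ × (∀ {x y} → Adj G x y → R (φ x) (φ y))

InducedAdj : {A V : Set} → (V → V → Set) → (A → V) → V → V → Set
InducedAdj R φ u v = (∃[ a ] φ a ≡ u) × (∃[ b ] φ b ≡ v) × R u v

IsResolvedEmbedding : (G : Graph) (k m : ℕ) (w : Fin k → Fin (n G))
                      (φ : Fin (n G) → PVert m k) → Set
IsResolvedEmbedding G k m w φ =
  IsEmbedding G (StrongAdj m k) φ
  × (∀ x i → IsDist (InducedAdj (StrongAdj m k) φ) (φ x) (φ (w i)) (toℕ (φ x i)))

module Submission where

-- In a W-resolved embedding the i-th coordinate of φ(x) is the distance from
-- φ(x) to φ(w_i) inside φ(G); in particular φ(w_i) has i-th coordinate 0.  Along any
-- walk in the strong product P_m^{⊠k} a single coordinate changes by at most one per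
-- step, so every walk from φ(x) to φ(w_i) in the whole product has length at least
-- the i-th coordinate of φ(x), i.e. at least the distance inside φ(G).  Conversely a
-- walk in the induced subgraph φ(G) is a walk in the product.  Hence the two
-- distances agree.

open import Defs
open import Data.Nat using (ℕ; suc; _≤_; _+_; s≤s)
open import Data.Nat.Properties
  using (≤-trans; ≤-refl; ≤-reflexive; n≤1+n; m≤n⇒m≤1+n; +-identityʳ; n≤0⇒n≡0)
open import Data.Fin using (Fin; toℕ)
open import Data.Product using (_,_; proj₁; proj₂)
open import Data.Sum using (inj₁; inj₂)
open import Function.Definitions using (Injective)
open import Relation.Binary.PropositionalEquality
  using (_≡_; cong; subst) renaming (sym to ≡-sym)

mapWalk : ∀ {V : Set} {R S : V → V → Set} →
  (∀ {a b} → R a b → S a b) → ∀ {u v l} → Walk R u v l → Walk S u v l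
mapWalk R⊆S here         = here
mapWalk R⊆S (step r rest) = step (R⊆S r) (mapWalk R⊆S rest)

induced⊆host : ∀ {A V : Set} {R : V → V → Set} {φ : A → V} {u v} →
  InducedAdj R φ u v → R u v
induced⊆host (_ , _ , r) = r

potential-≤-length : ∀ {V : Set} {R : V → V → Set} (f : V → ℕ) →
  (∀ {a b} → R a b → f a ≤ suc (f b)) →
  ∀ {u v l} → Walk R u v l → f u ≤ l + f v
potential-≤-length f step-bound here                  = ≤-refl
potential-≤-length f step-bound (step {y = y} r rest) =
  ≤-trans (step-bound r) (s≤s (potential-≤-length f step-bound rest))

coordinate-step : ∀ {m k} (i : Fin k) {u v : PVert m k} →
  StrongAdj m k u v → toℕ (u i) ≤ suc (toℕ (v i))
coordinate-step i {u} {v} (_ , coordinatewise) with coordinatewise i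
... | inj₁ same            = m≤n⇒m≤1+n (≤-reflexive (cong toℕ same))
... | inj₂ (inj₁ up)       = m≤n⇒m≤1+n (subst (toℕ (u i) ≤_) up (n≤1+n _))
... | inj₂ (inj₂ down)     = ≤-reflexive (≡-sym down)

-- In a resolved embedding, the landmark φ(w_i) has i-th coordinate 0, since that
-- coordinate is its distance to itself.
resolved-landmark-coordinate : ∀ (G : Graph) {k m} (w : Fin k → Fin (n G))
  (φ : Fin (n G) → PVert m k) → IsResolvedEmbedding G k m w φ →
  ∀ i → toℕ (φ (w i) i) ≡ 0
resolved-landmark-coordinate G w φ (_ , resolves) i =
  n≤0⇒n≡0 (proj₂ (resolves (w i) i) 0 here)

lemma3p1 : (G : Graph) (D k : ℕ) (w : Fin k → Fin (n G)) (φ : Fin (n G) → PVert (suc D) k) →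
    Connected G → HasDiameter G D → Injective _≡_ _≡_ w →
    IsResolvedEmbedding G k (suc D) w φ →
    ∀ (x : Fin (n G)) (i : Fin k) (d : ℕ) →
      IsDist (InducedAdj (StrongAdj (suc D) k) φ) (φ x) (φ (w i)) d →
      IsDist (StrongAdj (suc D) k) (φ x) (φ (w i)) d
lemma3p1 G D k w φ _ _ _ resolved x i d (induced-walk , induced-minimal) =
  mapWalk (induced⊆host {R = StrongAdj (suc D) k}) induced-walk , host-minimal
  where
    -- d is at most the i-th coordinate of φ(x), which is a length of an induced walk.
    d≤coordinate : d ≤ toℕ (φ x i)
    d≤coordinate = induced-minimal _ (proj₁ (proj₂ resolved x i))

    host-minimal : ∀ l → Walk (StrongAdj (suc D) k) (φ x) (φ (w i)) l → d ≤ l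
    host-minimal l walk = ≤-trans d≤coordinate (subst (toℕ (φ x i) ≤_) l+0≡l drop)
      where
        drop : toℕ (φ x i) ≤ l + toℕ (φ (w i) i)
        drop = potential-≤-length {R = StrongAdj (suc D) k} (λ u → toℕ (u i))
                 (coordinate-step i) walk
        l+0≡l : l + toℕ (φ (w i) i) ≡ l
        l+0≡l rewrite resolved-landmark-coordinate G w φ resolved i = +-identityʳ l
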